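{- Let $x,z$ be rational numbers. The point $(x,z/2)$ has rational Euclidean distance to both $(0,1/2)$ and $(0,-1/2)$ if and only if the polynomial $p_{x,z}(u)=u^4-(z^2+4x^2+1)u^2+z^2$ has a nonzero rational root. -}

module Defs where

open import Data.Rational using (ℚ; _+_; _*_; _-_; _≤_; 0ℚ; 1ℚ; ½)
open import Data.Product using (_×_; ∃; _,_)
open import Relation.Binary.PropositionalEquality using (_≡_)
open import Relation.Nullary using (¬_)

Point : Set
Point = ℚ × ℚ

dist² : Point → Point → ℚ
dist² (a , b) (c , d) = (a - c) * (a - c) + (b - d) * (b - d)

RationalDistance : Point → Point → Set
RationalDistance P Q = ∃ λ (d : ℚ) → (0ℚ ≤ d) × (d * d ≡ dist² P Q)

p : ℚ → ℚ → ℚ → ℚ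
p x z u = u * u * u * u - (z * z + 4ℚ * (x * x) + 1ℚ) * (u * u) + z * z
  where
  4ℚ : ℚ
  4ℚ = 1ℚ + 1ℚ + 1ℚ + 1ℚ

HasNonzeroRationalRoot : ℚ → ℚ → Set
HasNonzeroRationalRoot x z = ∃ λ (u : ℚ) → (¬ u ≡ 0ℚ) × (p x z u ≡ 0ℚ)

{-# OPTIONS --safe #-}
-- The polynomial  u⁴ - 2(a + b) u² + (a - b)²  is the product of the u - (±√a ± √b), so square
-- roots d, e ≥ 0 of a and b give the root d + e, nonzero unless a = b = 0.  Conversely a nonzero
-- root u determines  √a = (u + (a - b)/u)/2  and  √b = (u - (a - b)/u)/2  rationally.  For a and b
-- the squared distances from (x, z/2) to (0, ±1/2) this polynomial is exactly p_{x,z}.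
module Submission where

open import Defs
open import Data.Rational
  using (ℚ; _+_; _-_; _*_; -_; 1/_; ∣_∣; ½; 0ℚ; 1ℚ; _≤_; _<_; NonZero; NonNegative; ≢-nonZero)
open import Data.Rational.Properties
open import Data.Rational.Solver using (module +-*-Solver)
open import Data.Product using (_×_; _,_; ∃; map₂)
open import Data.Sum using (inj₁; inj₂)
open import Function.Bundles using (_⇔_; mk⇔)
open import Function.Properties.Equivalence using () renaming (trans to ⇔-trans)
open import Relation.Binary.PropositionalEquality
open import Relation.Nullary using (¬_)

open +-*-Solver

∣p∣*∣p∣≡p*p : ∀ p → ∣ p ∣ * ∣ p ∣ ≡ p * p
∣p∣*∣p∣≡p*p p with ∣p∣≡p∨∣p∣≡-p p
... | inj₁ ∣p∣≡p  rewrite ∣p∣≡p  = refl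
... | inj₂ ∣p∣≡-p rewrite ∣p∣≡-p = solve 1 (λ p → (:- p) :* (:- p) := p :* p) refl p

0≤p*p : ∀ p → 0ℚ ≤ p * p
0≤p*p p = subst (0ℚ ≤_) (∣p∣*∣p∣≡p*p p) (nonNegative⁻¹ (∣ p ∣ * ∣ p ∣) {{∣p∣*∣p∣-nonNeg}})
  where
  instance
    ∣p∣-nonNeg : NonNegative ∣ p ∣
    ∣p∣-nonNeg = ∣-∣-nonNeg p
  ∣p∣*∣p∣-nonNeg : NonNegative (∣ p ∣ * ∣ p ∣)
  ∣p∣*∣p∣-nonNeg = nonNeg*nonNeg⇒nonNeg (∣ p ∣) (∣ p ∣)

*-cancelʳ-≡ : ∀ {p q} r .{{_ : NonZero r}} → p * r ≡ q * r → p ≡ q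
*-cancelʳ-≡ {p} {q} r pr≡qr = begin
  p               ≡⟨ sym (p*r*1/r≡p p) ⟩
  p * r * (1/ r)  ≡⟨ cong (_* (1/ r)) pr≡qr ⟩
  q * r * (1/ r)  ≡⟨ p*r*1/r≡p q ⟩
  q               ∎
  where
  open ≡-Reasoning
  p*r*1/r≡p : ∀ p → p * r * (1/ r) ≡ p
  p*r*1/r≡p p = trans (*-assoc p r (1/ r)) (trans (cong (p *_) (*-inverseʳ r)) (*-identityʳ p))

nonNeg+nonNeg≡0⇒≡0 : ∀ {p q} → 0ℚ ≤ p → 0ℚ ≤ q → p + q ≡ 0ℚ → p ≡ 0ℚ
nonNeg+nonNeg≡0⇒≡0 {p} {q} 0≤p 0≤q p+q≡0 = ≤-antisym p≤0 0≤p
  where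
  p≤0 : p ≤ 0ℚ
  p≤0 = subst₂ _≤_ (+-identityʳ p) p+q≡0 (+-monoʳ-≤ p 0≤q)

HasRationalSqrt : ℚ → Set
HasRationalSqrt a = ∃ λ (d : ℚ) → (0ℚ ≤ d) × (d * d ≡ a)

hasRationalSqrt : ∀ {a} r → r * r ≡ a → HasRationalSqrt a
hasRationalSqrt r r*r≡a = ∣ r ∣ , 0≤∣p∣ r , trans (∣p∣*∣p∣≡p*p r) r*r≡a

biquadratic : ℚ → ℚ → ℚ → ℚ
biquadratic a b u = u * u * u * u - (a + b + (a + b)) * (u * u) + (a - b) * (a - b)

biquadratic-comm : ∀ a b u → biquadratic a b u ≡ biquadratic b a u
biquadratic-comm = solve 3 (λ a b u →
  u :* u :* u :* u :- (a :+ b :+ (a :+ b)) :* (u :* u) :+ (a :- b) :* (a :- b)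
  := u :* u :* u :* u :- (b :+ a :+ (b :+ a)) :* (u :* u) :+ (b :- a) :* (b :- a)) refl

biquadratic-root-+ : ∀ d e → biquadratic (d * d) (e * e) (d + e) ≡ 0ℚ
biquadratic-root-+ = solve 2 (λ d e →
  let a = d :* d ; b = e :* e ; u = d :+ e in
  u :* u :* u :* u :- (a :+ b :+ (a :+ b)) :* (u :* u) :+ (a :- b) :* (a :- b) := con 0ℚ) refl

-- Multiplying by u², the claim becomes  ((u² + a - b)/2)² = a u² + biquadratic a b u / 4.
biquadratic-root⇒square : ∀ a b u t .{{_ : NonZero u}} → u * t ≡ a - b →
                          biquadratic a b u ≡ 0ℚ → ((u + t) * ½) * ((u + t) * ½) ≡ a
biquadratic-root⇒square a b u t u*t≡a-b root = *-cancelʳ-≡ u (*-cancelʳ-≡ u (begin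
  half² (u + t) * u * u                  ≡⟨ expand-u*t u t ⟩
  half² (u * u + u * t)                  ≡⟨ cong (λ s → half² (u * u + s)) u*t≡a-b ⟩
  half² (u * u + (a - b))                ≡⟨ complete-square a b u ⟩
  a * u * u + ½ * ½ * biquadratic a b u  ≡⟨ cong (λ q → a * u * u + ½ * ½ * q) root ⟩
  a * u * u + ½ * ½ * 0ℚ                 ≡⟨ cong (a * u * u +_) (*-zeroʳ (½ * ½)) ⟩
  a * u * u + 0ℚ                         ≡⟨ +-identityʳ (a * u * u) ⟩
  a * u * u                              ∎))
  where
  open ≡-Reasoning
  half² : ℚ → ℚ
  half² s = (s * ½) * (s * ½)
  expand-u*t : ∀ u t → half² (u + t) * u * u ≡ half² (u * u + u * t)
  expand-u*t = solve 2 (λ u t →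
    (u :+ t) :* con ½ :* ((u :+ t) :* con ½) :* u :* u
    := (u :* u :+ u :* t) :* con ½ :* ((u :* u :+ u :* t) :* con ½)) refl
  complete-square : ∀ a b u → half² (u * u + (a - b)) ≡ a * u * u + ½ * ½ * biquadratic a b u
  complete-square = solve 3 (λ a b u →
    (u :* u :+ (a :- b)) :* con ½ :* ((u :* u :+ (a :- b)) :* con ½)
    := a :* u :* u :+ con ½ :* con ½
         :* (u :* u :* u :* u :- (a :+ b :+ (a :+ b)) :* (u :* u) :+ (a :- b) :* (a :- b))) refl

BiquadraticHasNonzeroRoot : ℚ → ℚ → Set
BiquadraticHasNonzeroRoot a b = ∃ λ u → (¬ u ≡ 0ℚ) × (biquadratic a b u ≡ 0ℚ)

bothSquares⇔biquadraticRoot : ∀ a b → 0ℚ < a + b →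
  (HasRationalSqrt a × HasRationalSqrt b) ⇔ BiquadraticHasNonzeroRoot a b
bothSquares⇔biquadraticRoot a b 0<a+b = mk⇔ roots⇒root root⇒roots
  where
  roots⇒root : HasRationalSqrt a × HasRationalSqrt b → BiquadraticHasNonzeroRoot a b
  roots⇒root ((d , 0≤d , d*d≡a) , (e , 0≤e , e*e≡b)) = d + e , d+e≢0 , root
    where
    root : biquadratic a b (d + e) ≡ 0ℚ
    root = subst₂ (λ a b → biquadratic a b (d + e) ≡ 0ℚ) d*d≡a e*e≡b (biquadratic-root-+ d e)
    d+e≢0 : ¬ d + e ≡ 0ℚ
    d+e≢0 d+e≡0 = <-irrefl (sym a+b≡0) 0<a+b
      where
      d≡0 : d ≡ 0ℚ
      d≡0 = nonNeg+nonNeg≡0⇒≡0 0≤d 0≤e d+e≡0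
      e≡0 : e ≡ 0ℚ
      e≡0 = nonNeg+nonNeg≡0⇒≡0 0≤e 0≤d (trans (+-comm e d) d+e≡0)
      a+b≡0 : a + b ≡ 0ℚ
      a+b≡0 = begin
        a + b                   ≡⟨ cong₂ _+_ (sym d*d≡a) (sym e*e≡b) ⟩
        d * d + e * e           ≡⟨ cong₂ (λ d e → d * d + e * e) d≡0 e≡0 ⟩
        0ℚ * 0ℚ + 0ℚ * 0ℚ        ≡⟨⟩
        0ℚ                      ∎
        where open ≡-Reasoning
  root⇒roots : BiquadraticHasNonzeroRoot a b → HasRationalSqrt a × HasRationalSqrt b
  root⇒roots (u , u≢0 , root) =
      hasRationalSqrt ((u + t) * ½) (biquadratic-root⇒square a b u t u*t≡a-b root)
    , hasRationalSqrt ((u - t) * ½) (biquadratic-root⇒square b a u (- t) u*-t≡b-a root′)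
    where
    instance
      u-nonZero : NonZero u
      u-nonZero = ≢-nonZero u≢0
    t : ℚ
    t = (a - b) * 1/ u
    u*t≡a-b : u * t ≡ a - b
    u*t≡a-b = trans (*-comm u t) (trans (*-assoc (a - b) (1/ u) u)
                (trans (cong ((a - b) *_) (*-inverseˡ u)) (*-identityʳ (a - b))))
    u*-t≡b-a : u * - t ≡ b - a
    u*-t≡b-a = trans (sym (neg-distribʳ-* u t))
                 (trans (cong -_ u*t≡a-b) (solve 2 (λ a b → :- (a :- b) := b :- a) refl a b))
    root′ : biquadratic b a u ≡ 0ℚ
    root′ = trans (sym (biquadratic-comm a b u)) root

dist²-nonNeg : ∀ P Q → 0ℚ ≤ dist² P Q
dist²-nonNeg (a , b) (c , d) = +-mono-≤ (0≤p*p (a - c)) (0≤p*p (b - d))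

parallelogram-dist² : ∀ x y h →
  dist² (x , y) (0ℚ , h) + dist² (x , y) (0ℚ , - h)
  ≡ dist² (x , y) (0ℚ , 0ℚ) + dist² (x , y) (0ℚ , 0ℚ) + (h * h + h * h)
parallelogram-dist² = solve 3 (λ x y h →
  let x² = (x :- con 0ℚ) :* (x :- con 0ℚ) in
  x² :+ (y :- h) :* (y :- h) :+ (x² :+ (y :- :- h) :* (y :- :- h))
  := x² :+ (y :- con 0ℚ) :* (y :- con 0ℚ) :+ (x² :+ (y :- con 0ℚ) :* (y :- con 0ℚ))
     :+ (h :* h :+ h :* h)) refl

p≡biquadratic-dist² : ∀ x z u →
  p x z u ≡ biquadratic (dist² (x , z * ½) (0ℚ , ½)) (dist² (x , z * ½) (0ℚ , - ½)) u
p≡biquadratic-dist² = solve 3 (λ x z u →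
  let a = (x :- con 0ℚ) :* (x :- con 0ℚ) :+ (z :* con ½ :- con ½) :* (z :* con ½ :- con ½)
      b = (x :- con 0ℚ) :* (x :- con 0ℚ) :+ (z :* con ½ :- con (- ½)) :* (z :* con ½ :- con (- ½))
      c = z :* z :+ (con 1ℚ :+ con 1ℚ :+ con 1ℚ :+ con 1ℚ) :* (x :* x) :+ con 1ℚ
  in u :* u :* u :* u :- c :* (u :* u) :+ z :* z
     := u :* u :* u :* u :- (a :+ b :+ (a :+ b)) :* (u :* u) :+ (a :- b) :* (a :- b)) refl

dist²-sum-pos : ∀ P → 0ℚ < dist² P (0ℚ , ½) + dist² P (0ℚ , - ½)
dist²-sum-pos P@(x , y) = <-respʳ-≡ (sym (parallelogram-dist² x y ½))
  (+-mono-≤-< (+-mono-≤ (dist²-nonNeg P O) (dist²-nonNeg P O)) (positive⁻¹ (½ * ½ + ½ * ½)))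
  where
  O : Point
  O = 0ℚ , 0ℚ

corollary1p4 : (x z : ℚ) → (RationalDistance (x , z * ½) (0ℚ , ½) × RationalDistance (x , z * ½) (0ℚ , - ½)) ⇔ HasNonzeroRationalRoot x z
corollary1p4 x z = ⇔-trans (bothSquares⇔biquadraticRoot _ _ (dist²-sum-pos (x , z * ½)))
  (mk⇔ (map₂ λ {u} → map₂ (trans (p≡biquadratic-dist² x z u)))
       (map₂ λ {u} → map₂ (trans (sym (p≡biquadratic-dist² x z u)))))
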